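{- Let $\hat{\mu}\colon \mathbb{Q}[z,z^{ -1}]\to\mathbb{Q}[[X,Y]]$ be the $\mathbb{Q}$-linear map defined by $$\hat{\mu}(z^k)=\begin{cases}-\sum_{i=1}^k e^{iX}e^{(k-i)Y} & (k>0),\\ 0 & (k=0),\\ \sum_{i=0}^{|k|-1}e^{ -iX}e^{(k+i)Y} & (k<0).\end{cases}$$ Then there is a unique continuous extension $\hat{\mu}\colon\mathbb{Q}[[Z]]\to\mathbb{Q}[[X,Y]]$ of this map.
   Context: $\mathbb{Q}[[Z]]$ and $\mathbb{Q}[[X,Y]]$ are formal power series rings. For $p\ge 0$, let $F^Z_p$ (resp. $F^{X,Y}_p$) be the set of power series in $\mathbb{Q}[[Z]]$ (resp. $\mathbb{Q}[[X,Y]]$) having only terms of total degree $\ge p$; these filtrations define the topologies on the two rings (so $\mathbb{Q}[[Z]]=\varprojlim_p \mathbb{Q}[[Z]]/F^Z_p$, and similarly for $\mathbb{Q}[[X,Y]]$). Set $z:=e^Z=\sum_{i\ge 0}Z^i/i!\in\mathbb{Q}[[Z]]$, so that the Laurent polynomial ring $\mathbb{Q}[z,z^{ -1}]$ is a subring of $\mathbb{Q}[[Z]]$, carrying the subspace topology; it is dense in $\mathbb{Q}[[Z]]$. Here $e^{iX}e^{jY}$ denotes the corresponding exponential power series in $\mathbb{Q}[[X,Y]]$. -}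

module Defs where

open import Data.Nat using (ℕ; zero; suc; _+_; _<_; _!)
open import Data.Nat.Properties using (_!≢0)
open import Data.Integer using (ℤ; +_; -[1+_]; _^_) renaming (-_ to -ℤ_)
open import Data.Rational using (ℚ; 0ℚ; _/_) renaming (_+_ to _+ℚ_; _*_ to _*ℚ_; -_ to -ℚ_)
open import Data.List using (List; []; _∷_)
open import Data.Product using (_×_; _,_; ∃)
open import Relation.Binary.PropositionalEquality using (_≡_)

-- Formal power series in one variable Z over ℚ: n ↦ coefficient of Z^n.
PS1 : Set
PS1 = ℕ → ℚ

-- Formal power series in X, Y over ℚ: (a , b) ↦ coefficient of X^a Y^b.
PS2 : Set
PS2 = ℕ → ℕ → ℚ

_≈₁_ : PS1 → PS1 → Set
f ≈₁ g = ∀ n → f n ≡ g n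

_≈₂_ : PS2 → PS2 → Set
F ≈₂ G = ∀ a b → F a b ≡ G a b

_⊕₂_ : PS2 → PS2 → PS2
(F ⊕₂ G) a b = F a b +ℚ G a b

⊝₂_ : PS2 → PS2
(⊝₂ F) a b = -ℚ F a b

_⊙₂_ : ℚ → PS2 → PS2
(c ⊙₂ F) a b = c *ℚ F a b

zero₂ : PS2
zero₂ _ _ = 0ℚ

expCoef : ℤ → ℕ → ℚ
expCoef c n = (c ^ n) / (n !) where instance _ = n !≢0

expZ : ℤ → PS1
expZ c n = expCoef c n

expXY : ℤ → ℤ → PS2
expXY i j a b = expCoef i a *ℚ expCoef j b

-- Laurent polynomials in z: formal finite sums  Σ c · z^k  given as lists of (k , c).
Laurent : Set
Laurent = List (ℤ × ℚ)

-- the inclusion ℚ[z,z⁻¹] ⊆ ℚ[[Z]], z = e^Z, so z^k = e^{kZ}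
embed : Laurent → PS1
embed []            n = 0ℚ
embed ((k , c) ∷ L) n = (c *ℚ expZ k n) +ℚ embed L n

sum0to : ℕ → (ℕ → PS2) → PS2
sum0to zero    f = f 0
sum0to (suc n) f = sum0to n f ⊕₂ f (suc n)

sum1to : ℕ → (ℕ → PS2) → PS2
sum1to zero    f = zero₂
sum1to (suc n) f = sum1to n f ⊕₂ f (suc n)

μmono : ℤ → PS2
μmono (+ zero)    = zero₂
μmono (+ suc n)   = ⊝₂ sum1to (suc n) (λ i → expXY (+ i) (+ (suc n) Data.Integer.- + i))
μmono -[1+ n ]    = sum0to n (λ i → expXY (-ℤ (+ i)) (-[1+ n ] Data.Integer.+ + i))

μ̂ : Laurent → PS2
μ̂ []            = zero₂
μ̂ ((k , c) ∷ L) = (c ⊙₂ μmono k) ⊕₂ μ̂ L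

-- Continuity for the filtration topologies (F^Z_q, F^{X,Y}_p):
-- for every f and p there is q such that g ∈ f + F^Z_q implies Φ g ∈ Φ f + F^{X,Y}_p.
Continuous : (PS1 → PS2) → Set
Continuous Φ = ∀ (f : PS1) (p : ℕ) → ∃ λ (q : ℕ) → ∀ (g : PS1) →
  (∀ n → n < q → f n ≡ g n) → (∀ a b → a + b < p → Φ f a b ≡ Φ g a b)

Extends : (PS1 → PS2) → Set
Extends Φ = ∀ (L : Laurent) → Φ (embed L) ≈₂ μ̂ L

module Submission where

-- For a Laurent polynomial L = Σ c·z^k and φ : ℤ → ℚ write ⟨L , φ⟩ = Σ c·φ(k).
-- Both maps in the statement are such pairings: the Z^n-coefficient of L ∈ ℚ[[Z]]
-- is ⟨L , k ↦ k^n/n!⟩ and the X^a Y^b-coefficient of μ̂ L is ⟨L , k ↦ μ̂(z^k)_{a,b}⟩.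
-- Call φ of order ≤ d when ⟨L , φ⟩ depends only on the coefficients of Z^0,…,Z^d in L.
--
-- (1) Locality: k ↦ μ̂(z^k)_{a,b} has order ≤ a+b+1.  Up to sign it is the signed sum
--     Σ_{0<i≤k} e_a(i)·e_b(k-i) with e_n(x) = x^n/n!.  We induct on b, using
--     e_{b+1}(x) = x·e_b(x)/(b+1) and that multiplication by k raises the order by one;
--     the base b = 0 is the summatory function of e_a, a polynomial of degree a+1 in k
--     (Newton interpolation in falling factorials).
-- (2) Density: (z-1)^N = Z^N + O(Z^{N+1}), so every truncation of a power series is the
--     truncation of a Laurent polynomial.
-- The extension sends f to the series whose X^a Y^b-coefficient is that of μ̂ A, for a
-- Laurent polynomial A agreeing with f up to Z^{a+b+1}.  By (1) this does not depend on
-- the choice of A, which yields continuity, the extension property and uniqueness.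

open import Defs

open import Level using (0ℓ)
open import Relation.Nullary.Decidable.Core using (dec⇒maybe)
open import Data.Nat as ℕ using (ℕ; zero; suc; _!; _≤_; _<_; s≤s; z≤n)
import Data.Nat.Properties as ℕP
open import Data.Integer as ℤ using (ℤ; +_; -[1+_])
import Data.Integer.Properties as ℤP
open import Data.Integer.Tactic.RingSolver as ℤR using ()
open import Data.Rational as ℚ using (ℚ; 0ℚ; 1ℚ; _+_; _*_; _-_; -_; _/_)
import Data.Rational.Properties as ℚP
open import Data.Rational.Unnormalised as ℚᵘ using (mkℚᵘ; *≡*)
import Data.Rational.Unnormalised.Properties as ℚᵘP
open import Algebra.Properties.Group ℚP.+-0-group
  using () renaming (∙-cancelʳ to +-cancelʳ; ⁻¹-involutive to neg-involutive)
open import Relation.Binary.PropositionalEquality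
open import Data.Product using (Σ; _,_; proj₁; proj₂; _×_)
open import Data.Sum using (inj₁; inj₂)
open import Data.List using (List; []; _∷_; _++_; length; map)
open import Data.List.Properties using (length-map)
import Tactic.RingSolver.Core.AlmostCommutativeRing as ACR
open import Tactic.RingSolver using (solve-∀)

ℚ-ring : ACR.AlmostCommutativeRing 0ℓ 0ℓ
ℚ-ring = ACR.fromCommutativeRing ℚP.+-*-commutativeRing (λ x → dec⇒maybe (0ℚ ℚP.≟ x))

fromℚᵘ-+ : ∀ p q → ℚ.fromℚᵘ (p ℚᵘ.+ q) ≡ ℚ.fromℚᵘ p + ℚ.fromℚᵘ q
fromℚᵘ-+ p q = ℚP.toℚᵘ-injective (ℚᵘP.≃-trans (ℚP.toℚᵘ-fromℚᵘ (p ℚᵘ.+ q))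
  (ℚᵘP.≃-trans (ℚᵘP.+-cong (ℚᵘP.≃-sym (ℚP.toℚᵘ-fromℚᵘ p)) (ℚᵘP.≃-sym (ℚP.toℚᵘ-fromℚᵘ q)))
               (ℚᵘP.≃-sym (ℚP.toℚᵘ-homo-+ (ℚ.fromℚᵘ p) (ℚ.fromℚᵘ q)))))

fromℚᵘ-* : ∀ p q → ℚ.fromℚᵘ (p ℚᵘ.* q) ≡ ℚ.fromℚᵘ p * ℚ.fromℚᵘ q
fromℚᵘ-* p q = ℚP.toℚᵘ-injective (ℚᵘP.≃-trans (ℚP.toℚᵘ-fromℚᵘ (p ℚᵘ.* q))
  (ℚᵘP.≃-trans (ℚᵘP.*-cong (ℚᵘP.≃-sym (ℚP.toℚᵘ-fromℚᵘ p)) (ℚᵘP.≃-sym (ℚP.toℚᵘ-fromℚᵘ q)))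
               (ℚᵘP.≃-sym (ℚP.toℚᵘ-homo-* (ℚ.fromℚᵘ p) (ℚ.fromℚᵘ q)))))

fromℚᵘ-neg : ∀ p → ℚ.fromℚᵘ (ℚᵘ.- p) ≡ - ℚ.fromℚᵘ p
fromℚᵘ-neg p = ℚP.toℚᵘ-injective (ℚᵘP.≃-trans (ℚP.toℚᵘ-fromℚᵘ (ℚᵘ.- p))
  (ℚᵘP.≃-trans (ℚᵘP.-‿cong (ℚᵘP.≃-sym (ℚP.toℚᵘ-fromℚᵘ p)))
               (ℚᵘP.≃-sym (ℚP.toℚᵘ-homo‿- (ℚ.fromℚᵘ p)))))

/-* : ∀ x y a b → (x / suc a) * (y / suc b) ≡ (x ℤ.* y) / (suc a ℕ.* suc b)
/-* x y a b = sym (fromℚᵘ-* (mkℚᵘ x a) (mkℚᵘ y b))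

/-cross : ∀ x y a b → x ℤ.* + suc b ≡ y ℤ.* + suc a → x / suc a ≡ y / suc b
/-cross x y a b eq = ℚP.fromℚᵘ-cong {mkℚᵘ x a} {mkℚᵘ y b} (*≡* eq)

fromℤ : ℤ → ℚ
fromℤ k = k / 1

fromℤ-+ : ∀ a b → fromℤ (a ℤ.+ b) ≡ fromℤ a + fromℤ b
fromℤ-+ a b = trans (ℚP.fromℚᵘ-cong {mkℚᵘ (a ℤ.+ b) 0} {mkℚᵘ a 0 ℚᵘ.+ mkℚᵘ b 0} (*≡* (sol a b)))
                    (fromℚᵘ-+ (mkℚᵘ a 0) (mkℚᵘ b 0))
  where
  sol : ∀ a b → (a ℤ.+ b) ℤ.* + 1 ≡ (a ℤ.* + 1 ℤ.+ b ℤ.* + 1) ℤ.* + 1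
  sol = ℤR.solve-∀

fromℤ-- : ∀ a b → fromℤ (a ℤ.- b) ≡ fromℤ a - fromℤ b
fromℤ-- a b = trans (fromℤ-+ a (ℤ.- b)) (cong (λ v → fromℤ a + v) (fromℚᵘ-neg (mkℚᵘ b 0)))

fromℤ-suc : ∀ k → fromℤ (ℤ.suc k) ≡ fromℤ k + 1ℚ
fromℤ-suc k = trans (fromℤ-+ (+ 1) k) (ℚP.+-comm 1ℚ (fromℤ k))

-- Naturals in ℚ, by recursion, so that fromℕ (suc n) unfolds to fromℕ n + 1.
fromℕ : ℕ → ℚ
fromℕ zero    = 0ℚ
fromℕ (suc j) = fromℕ j + 1ℚ

fromℕ≡fromℤ : ∀ j → fromℕ j ≡ fromℤ (+ j)
fromℕ≡fromℤ zero    = refl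
fromℕ≡fromℤ (suc j) = trans (cong (_+ 1ℚ) (fromℕ≡fromℤ j)) (sym (fromℤ-suc (+ j)))

recip : ℕ → ℚ
recip n = + 1 / suc n

fromℕ-recip : ∀ n → fromℕ (suc n) * recip n ≡ 1ℚ
fromℕ-recip n = trans (cong (_* recip n) (fromℕ≡fromℤ (suc n)))
  (trans (/-* (+ suc n) (+ 1) 0 n) (/-cross (+ suc n ℤ.* + 1) (+ 1) (n ℕ.+ 0 ℕ.* suc n) 0 eq))
  where
  eq : (+ suc n ℤ.* + 1) ℤ.* + 1 ≡ + 1 ℤ.* + (1 ℕ.* suc n)
  eq = trans (ℤP.*-identityʳ _) (trans (ℤP.*-identityʳ _)
         (trans (cong +_ (sym (ℕP.*-identityˡ (suc n)))) (sym (ℤP.*-identityˡ _))))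

-- e n k is the Z^n-coefficient of z^k = e^{kZ}.
e : ℕ → ℤ → ℚ
e n k = expCoef k n

-- n! as a successor, to expose the denominator of e n k as a fraction.
n!≡suc : ∀ n → Σ ℕ (λ m → n ! ≡ suc m)
n!≡suc n with n ! | ℕP.1≤n! n
... | suc m | _ = m , refl

e-as-fraction : ∀ c n m → n ! ≡ suc m → e n c ≡ (c ℤ.^ n) / suc m
e-as-fraction c n m eq = ℚP./-cong {c ℤ.^ n} {n !} {c ℤ.^ n} {suc m} {{n ℕP.!≢0}} refl eq

e-step : ∀ k n → fromℤ k * e n k ≡ fromℕ (suc n) * e (suc n) k
e-step c n = begin
    fromℤ c * e n c
  ≡⟨ cong (fromℤ c *_) (e-as-fraction c n m n!≡m+1) ⟩
    fromℤ c * ((c ℤ.^ n) / suc m)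
  ≡⟨ /-* c (c ℤ.^ n) 0 m ⟩
    (c ℤ.* (c ℤ.^ n)) / (1 ℕ.* suc m)
  ≡⟨ /-cross (c ℤ.* (c ℤ.^ n)) (+ suc n ℤ.* (c ℤ.* (c ℤ.^ n)))
             (m ℕ.+ 0 ℕ.* suc m) (m ℕ.+ n ℕ.* suc m ℕ.+ 0 ℕ.* (suc n ℕ.* suc m)) cross ⟩
    (+ suc n ℤ.* (c ℤ.* (c ℤ.^ n))) / (1 ℕ.* (suc n ℕ.* suc m))
  ≡⟨ sym (/-* (+ suc n) (c ℤ.* (c ℤ.^ n)) 0 (m ℕ.+ n ℕ.* suc m)) ⟩
    fromℤ (+ suc n) * ((c ℤ.* (c ℤ.^ n)) / (suc n ℕ.* suc m))
  ≡⟨ cong₂ _*_ (sym (fromℕ≡fromℤ (suc n)))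
       (sym (e-as-fraction c (suc n) (m ℕ.+ n ℕ.* suc m) (cong (suc n ℕ.*_) n!≡m+1))) ⟩
    fromℕ (suc n) * e (suc n) c
  ∎
  where
  open ≡-Reasoning
  m = proj₁ (n!≡suc n)
  n!≡m+1 = proj₂ (n!≡suc n)
  cⁿ = c ℤ.^ n
  sol : ∀ c x s d → (c ℤ.* x) ℤ.* (+ 1 ℤ.* (s ℤ.* d)) ≡ (s ℤ.* (c ℤ.* x)) ℤ.* (+ 1 ℤ.* d)
  sol = ℤR.solve-∀
  cross : (c ℤ.* cⁿ) ℤ.* + (1 ℕ.* (suc n ℕ.* suc m)) ≡ (+ suc n ℤ.* (c ℤ.* cⁿ)) ℤ.* + (1 ℕ.* suc m)
  cross = trans (cong ((c ℤ.* cⁿ) ℤ.*_) (trans (ℤP.pos-* 1 _) (cong (+ 1 ℤ.*_) (ℤP.pos-* (suc n) (suc m)))))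
            (trans (sol c cⁿ (+ suc n) (+ suc m))
                   (cong ((+ suc n ℤ.* (c ℤ.* cⁿ)) ℤ.*_) (sym (ℤP.pos-* 1 (suc m)))))

e-suc : ∀ k n → e (suc n) k ≡ recip n * (fromℤ k * e n k)
e-suc k n = begin
    e (suc n) k
  ≡⟨ sym (ℚP.*-identityˡ _) ⟩
    1ℚ * e (suc n) k
  ≡⟨ cong (_* e (suc n) k) (sym (trans (ℚP.*-comm (recip n) (fromℕ (suc n))) (fromℕ-recip n))) ⟩
    (recip n * fromℕ (suc n)) * e (suc n) k
  ≡⟨ ℚP.*-assoc (recip n) (fromℕ (suc n)) (e (suc n) k) ⟩
    recip n * (fromℕ (suc n) * e (suc n) k)
  ≡⟨ cong (recip n *_) (sym (e-step k n)) ⟩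
    recip n * (fromℤ k * e n k)
  ∎
  where open ≡-Reasoning

-- Pairing Laurent polynomials with functions ℤ → ℚ

pair : Laurent → (ℤ → ℚ) → ℚ
pair []            φ = 0ℚ
pair ((k , c) ∷ L) φ = c * φ k + pair L φ

embed≡pair : ∀ L n → embed L n ≡ pair L (e n)
embed≡pair []            n = refl
embed≡pair ((k , c) ∷ L) n = cong (λ v → c * e n k + v) (embed≡pair L n)

μ̂≡pair : ∀ L a b → μ̂ L a b ≡ pair L (λ k → μmono k a b)
μ̂≡pair []            a b = refl
μ̂≡pair ((k , c) ∷ L) a b = cong (λ v → c * μmono k a b + v) (μ̂≡pair L a b)

pair-cong : ∀ L {φ ψ : ℤ → ℚ} → (∀ k → φ k ≡ ψ k) → pair L φ ≡ pair L ψ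
pair-cong []            eq = refl
pair-cong ((k , c) ∷ L) eq = cong₂ (λ u v → c * u + v) (eq k) (pair-cong L eq)

pair-zero : ∀ L → pair L (λ _ → 0ℚ) ≡ 0ℚ
pair-zero []            = refl
pair-zero ((k , c) ∷ L) = trans (cong (λ v → c * 0ℚ + v) (pair-zero L)) (sol c)
  where
  sol : ∀ c → c * 0ℚ + 0ℚ ≡ 0ℚ
  sol = solve-∀ ℚ-ring

pair-+ : ∀ L (φ ψ : ℤ → ℚ) → pair L (λ k → φ k + ψ k) ≡ pair L φ + pair L ψ
pair-+ []            φ ψ = sym (ℚP.+-identityˡ 0ℚ)
pair-+ ((k , c) ∷ L) φ ψ = trans (cong (λ v → c * (φ k + ψ k) + v) (pair-+ L φ ψ))
                                 (sol c (φ k) (ψ k) (pair L φ) (pair L ψ))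
  where
  sol : ∀ c x y P Q → c * (x + y) + (P + Q) ≡ (c * x + P) + (c * y + Q)
  sol = solve-∀ ℚ-ring

pair-scale : ∀ L α (φ : ℤ → ℚ) → pair L (λ k → α * φ k) ≡ α * pair L φ
pair-scale []            α φ = sym (ℚP.*-zeroʳ α)
pair-scale ((k , c) ∷ L) α φ = trans (cong (λ v → c * (α * φ k) + v) (pair-scale L α φ))
                                     (sol c α (φ k) (pair L φ))
  where
  sol : ∀ c α x P → c * (α * x) + α * P ≡ α * (c * x + P)
  sol = solve-∀ ℚ-ring

pair-++ : ∀ L M φ → pair (L ++ M) φ ≡ pair L φ + pair M φ
pair-++ []            M φ = sym (ℚP.+-identityˡ _)
pair-++ ((k , c) ∷ L) M φ =
  trans (cong (λ v → c * φ k + v) (pair-++ L M φ)) (sym (ℚP.+-assoc (c * φ k) (pair L φ) (pair M φ)))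

scaleL : ℚ → Laurent → Laurent
scaleL α []            = []
scaleL α ((k , c) ∷ L) = (k , α * c) ∷ scaleL α L

pair-scaleL : ∀ α L φ → pair (scaleL α L) φ ≡ α * pair L φ
pair-scaleL α []            φ = sym (ℚP.*-zeroʳ α)
pair-scaleL α ((k , c) ∷ L) φ =
  trans (cong (λ v → α * c * φ k + v) (pair-scaleL α L φ)) (sol α c (φ k) (pair L φ))
  where
  sol : ∀ α c x P → α * c * x + α * P ≡ α * (c * x + P)
  sol = solve-∀ ℚ-ring

shiftL : Laurent → Laurent
shiftL []            = []
shiftL ((k , c) ∷ L) = (ℤ.suc k , c) ∷ shiftL L

pair-shiftL : ∀ L φ → pair (shiftL L) φ ≡ pair L (λ k → φ (ℤ.suc k))
pair-shiftL []            φ = refl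
pair-shiftL ((k , c) ∷ L) φ = cong (λ v → c * φ (ℤ.suc k) + v) (pair-shiftL L φ)

weightL : Laurent → Laurent
weightL []            = []
weightL ((k , c) ∷ L) = (k , c * fromℤ k) ∷ weightL L

pair-weightL : ∀ L φ → pair (weightL L) φ ≡ pair L (λ k → fromℤ k * φ k)
pair-weightL []            φ = refl
pair-weightL ((k , c) ∷ L) φ = cong₂ _+_ (ℚP.*-assoc c (fromℤ k) (φ k)) (pair-weightL L φ)

-- Functions of finite order

-- φ has order ≤ d when ⟨L , φ⟩ = 0 for every L whose image in ℚ[[Z]] lies in F^Z_{d+1},
-- i.e. the functional ⟨- , φ⟩ factors through ℚ[[Z]]/F^Z_{d+1}.
Order≤ : ℕ → (ℤ → ℚ) → Set
Order≤ d φ = ∀ L → (∀ n → n ≤ d → pair L (e n) ≡ 0ℚ) → pair L φ ≡ 0ℚ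

order-cong : ∀ {d φ ψ} → (∀ k → φ k ≡ ψ k) → Order≤ d φ → Order≤ d ψ
order-cong eq ord L h = trans (sym (pair-cong L eq)) (ord L h)

order-zero : ∀ {d} → Order≤ d (λ _ → 0ℚ)
order-zero L h = pair-zero L

order-+ : ∀ {d φ ψ} → Order≤ d φ → Order≤ d ψ → Order≤ d (λ k → φ k + ψ k)
order-+ {φ = φ} {ψ} ordφ ordψ L h =
  trans (pair-+ L φ ψ) (trans (cong₂ _+_ (ordφ L h) (ordψ L h)) (ℚP.+-identityˡ 0ℚ))

order-scale : ∀ {d φ} α → Order≤ d φ → Order≤ d (λ k → α * φ k)
order-scale {φ = φ} α ord L h = trans (pair-scale L α φ) (trans (cong (α *_) (ord L h)) (ℚP.*-zeroʳ α))

order-e : ∀ {d} n → n ≤ d → Order≤ d (e n)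
order-e n n≤d L h = h n n≤d

order-mono : ∀ {d d′ φ} → d ≤ d′ → Order≤ d φ → Order≤ d′ φ
order-mono d≤d′ ord L h = ord L (λ n n≤d → h n (ℕP.≤-trans n≤d d≤d′))

-- … and multiplication by k raises the order by one, since k·e_n(k) = (n+1)·e_{n+1}(k).
order-weight : ∀ {d φ} → Order≤ d φ → Order≤ (suc d) (λ k → fromℤ k * φ k)
order-weight {d} {φ} ord L h = trans (sym (pair-weightL L φ)) (ord (weightL L) weighted)
  where
  weighted : ∀ n → n ≤ d → pair (weightL L) (e n) ≡ 0ℚ
  weighted n n≤d = begin
      pair (weightL L) (e n)
    ≡⟨ pair-weightL L (e n) ⟩
      pair L (λ k → fromℤ k * e n k)
    ≡⟨ pair-cong L (λ k → e-step k n) ⟩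
      pair L (λ k → fromℕ (suc n) * e (suc n) k)
    ≡⟨ pair-scale L (fromℕ (suc n)) (e (suc n)) ⟩
      fromℕ (suc n) * pair L (e (suc n))
    ≡⟨ cong (fromℕ (suc n) *_) (h (suc n) (s≤s n≤d)) ⟩
      fromℕ (suc n) * 0ℚ
    ≡⟨ ℚP.*-zeroʳ (fromℕ (suc n)) ⟩
      0ℚ
    ∎
    where open ≡-Reasoning

-- Pairings with a function of order ≤ d agree on Laurent polynomials whose images in
-- ℚ[[Z]] agree up to Z^d (apply the definition to L - M).
order-agree : ∀ {d φ} → Order≤ d φ → ∀ L M →
              (∀ n → n ≤ d → pair L (e n) ≡ pair M (e n)) → pair L φ ≡ pair M φ
order-agree {d} {φ} ord L M agree = begin
    pair L φ
  ≡⟨ sol (pair L φ) (pair M φ) ⟩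
    (pair L φ + (- 1ℚ) * pair M φ) + pair M φ
  ≡⟨ cong (_+ pair M φ) (sym (pair-difference φ)) ⟩
    pair (L ++ scaleL (- 1ℚ) M) φ + pair M φ
  ≡⟨ cong (_+ pair M φ) (ord (L ++ scaleL (- 1ℚ) M) difference-vanishes) ⟩
    0ℚ + pair M φ
  ≡⟨ ℚP.+-identityˡ (pair M φ) ⟩
    pair M φ
  ∎
  where
  open ≡-Reasoning
  sol : ∀ x y → x ≡ (x + (- 1ℚ) * y) + y
  sol = solve-∀ ℚ-ring
  pair-difference : ∀ ψ → pair (L ++ scaleL (- 1ℚ) M) ψ ≡ pair L ψ + (- 1ℚ) * pair M ψ
  pair-difference ψ = trans (pair-++ L _ ψ) (cong (λ v → pair L ψ + v) (pair-scaleL (- 1ℚ) M ψ))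
  cancel : ∀ x → x + (- 1ℚ) * x ≡ 0ℚ
  cancel = solve-∀ ℚ-ring
  difference-vanishes : ∀ n → n ≤ d → pair (L ++ scaleL (- 1ℚ) M) (e n) ≡ 0ℚ
  difference-vanishes n n≤d = trans (pair-difference (e n))
    (trans (cong (λ v → v + (- 1ℚ) * pair M (e n)) (agree n n≤d)) (cancel (pair M (e n))))

-- Polynomial functions, in the Newton basis of falling factorials

falling : ℕ → ℚ → ℚ
falling zero    x = 1ℚ
falling (suc j) x = falling j x * (x - fromℕ j)

falling-Δ : ∀ j x → falling (suc j) (x + 1ℚ) ≡ falling (suc j) x + fromℕ (suc j) * falling j x
falling-Δ zero    x = sol x
  where
  sol : ∀ x → 1ℚ * (x + 1ℚ - 0ℚ) ≡ 1ℚ * (x - 0ℚ) + (0ℚ + 1ℚ) * 1ℚ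
  sol = solve-∀ ℚ-ring
falling-Δ (suc j) x =
  trans (cong (_* (x + 1ℚ - fromℕ (suc j))) (falling-Δ j x)) (sol (falling j x) x (fromℕ j))
  where
  sol : ∀ A x s → (A * (x - s) + (s + 1ℚ) * A) * (x + 1ℚ - (s + 1ℚ))
                ≡ A * (x - s) * (x - (s + 1ℚ)) + ((s + 1ℚ) + 1ℚ) * (A * (x - s))
  sol = solve-∀ ℚ-ring

falling-at-0 : ∀ j → falling (suc j) 0ℚ ≡ 0ℚ
falling-at-0 zero    = refl
falling-at-0 (suc j) =
  trans (cong (_* (0ℚ - fromℕ (suc j))) (falling-at-0 j)) (ℚP.*-zeroˡ (0ℚ - fromℕ (suc j)))

falling-times-x : ∀ j x → x * falling j x ≡ falling (suc j) x + fromℕ j * falling j x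
falling-times-x j x = sol x (falling j x) (fromℕ j)
  where
  sol : ∀ x A s → x * A ≡ A * (x - s) + s * A
  sol = solve-∀ ℚ-ring

newton : ℕ → List ℚ → ℚ → ℚ
newton j []       x = 0ℚ
newton j (c ∷ cs) x = c * falling j x + newton (suc j) cs x

newton-at-0 : ∀ j cs → newton (suc j) cs 0ℚ ≡ 0ℚ
newton-at-0 j []       = refl
newton-at-0 j (c ∷ cs) =
  trans (cong₂ (λ u v → c * u + v) (falling-at-0 j) (newton-at-0 (suc j) cs)) (sol c)
  where
  sol : ∀ c → c * 0ℚ + 0ℚ ≡ 0ℚ
  sol = solve-∀ ℚ-ring

newton-scale : ∀ j α cs x → newton j (map (α *_) cs) x ≡ α * newton j cs x
newton-scale j α []       x = sym (ℚP.*-zeroʳ α)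
newton-scale j α (c ∷ cs) x =
  trans (cong (λ v → α * c * falling j x + v) (newton-scale (suc j) α cs x))
        (sol α c (falling j x) (newton (suc j) cs x))
  where
  sol : ∀ α c F N → α * c * F + α * N ≡ α * (c * F + N)
  sol = solve-∀ ℚ-ring

-- Coefficients of an antidifference: c·x^{(j)} = Δ (c/(j+1)·x^{(j+1)}).
antidiff : ℕ → List ℚ → List ℚ
antidiff j []       = []
antidiff j (c ∷ cs) = (c * recip j) ∷ antidiff (suc j) cs

antidiff-length : ∀ j cs → length (antidiff j cs) ≡ length cs
antidiff-length j []       = refl
antidiff-length j (c ∷ cs) = cong suc (antidiff-length (suc j) cs)

newton-antidiff : ∀ j cs x → newton (suc j) (antidiff j cs) (x + 1ℚ)
                           ≡ newton (suc j) (antidiff j cs) x + newton j cs x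
newton-antidiff j []       x = sym (ℚP.+-identityʳ 0ℚ)
newton-antidiff j (c ∷ cs) x = begin
    c * r * falling (suc j) (x + 1ℚ) + N (x + 1ℚ)
  ≡⟨ cong₂ (λ u v → c * r * u + v) (falling-Δ j x) (newton-antidiff (suc j) cs x) ⟩
    c * r * (falling (suc j) x + s * falling j x) + (N x + newton (suc j) cs x)
  ≡⟨ sol c r s (falling j x) (falling (suc j) x) (N x) (newton (suc j) cs x) ⟩
    (c * r * falling (suc j) x + N x) + (c * (s * r) * falling j x + newton (suc j) cs x)
  ≡⟨ cong (λ t → (c * r * falling (suc j) x + N x) + (c * t * falling j x + newton (suc j) cs x))
          (fromℕ-recip j) ⟩
    (c * r * falling (suc j) x + N x) + (c * 1ℚ * falling j x + newton (suc j) cs x)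
  ≡⟨ cong (λ t → (c * r * falling (suc j) x + N x) + (t * falling j x + newton (suc j) cs x))
          (ℚP.*-identityʳ c) ⟩
    (c * r * falling (suc j) x + N x) + (c * falling j x + newton (suc j) cs x)
  ∎
  where
  open ≡-Reasoning
  r = recip j
  s = fromℕ (suc j)
  N : ℚ → ℚ
  N = newton (suc (suc j)) (antidiff (suc j) cs)
  sol : ∀ c q i F F1 N M → c * q * (F1 + i * F) + (N + M) ≡ (c * q * F1 + N) + (c * (i * q) * F + M)
  sol = solve-∀ ℚ-ring

-- Coefficients of x times a Newton form, via x·x^{(j)} = x^{(j+1)} + j·x^{(j)}.
addToHead : ℚ → List ℚ → List ℚ
addToHead a []       = a ∷ []
addToHead a (d ∷ ds) = (a + d) ∷ ds

newton-addToHead : ∀ j a ds x → newton j (addToHead a ds) x ≡ a * falling j x + newton j ds x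
newton-addToHead j a []       x = refl
newton-addToHead j a (d ∷ ds) x = sol a d (falling j x) (newton (suc j) ds x)
  where
  sol : ∀ a d F N → (a + d) * F + N ≡ a * F + (d * F + N)
  sol = solve-∀ ℚ-ring

timesX : ℕ → List ℚ → List ℚ
timesX j []       = []
timesX j (c ∷ cs) = (c * fromℕ j) ∷ addToHead c (timesX (suc j) cs)

newton-timesX : ∀ j cs x → newton j (timesX j cs) x ≡ x * newton j cs x
newton-timesX j []       x = sym (ℚP.*-zeroʳ x)
newton-timesX j (c ∷ cs) x = begin
    c * fromℕ j * falling j x + newton (suc j) (addToHead c (timesX (suc j) cs)) x
  ≡⟨ cong (λ v → c * fromℕ j * falling j x + v) (newton-addToHead (suc j) c (timesX (suc j) cs) x) ⟩
    c * fromℕ j * falling j x + (c * falling (suc j) x + newton (suc j) (timesX (suc j) cs) x)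
  ≡⟨ cong (λ v → c * fromℕ j * falling j x + (c * falling (suc j) x + v)) (newton-timesX (suc j) cs x) ⟩
    c * fromℕ j * falling j x + (c * falling (suc j) x + x * N)
  ≡⟨ sol c (fromℕ j) (falling j x) (falling (suc j) x) x N ⟩
    c * (falling (suc j) x + fromℕ j * falling j x) + x * N
  ≡⟨ cong (λ v → c * v + x * N) (sym (falling-times-x j x)) ⟩
    c * (x * falling j x) + x * N
  ≡⟨ sol2 c x (falling j x) N ⟩
    x * (c * falling j x + N)
  ∎
  where
  open ≡-Reasoning
  N = newton (suc j) cs x
  sol : ∀ c s F F1 x N → c * s * F + (c * F1 + x * N) ≡ c * (F1 + s * F) + x * N
  sol = solve-∀ ℚ-ring
  sol2 : ∀ c x F N → c * (x * F) + x * N ≡ x * (c * F + N)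
  sol2 = solve-∀ ℚ-ring

timesX-length : ∀ j cs → length (timesX j cs) ≤ suc (length cs)
timesX-length j []       = z≤n
timesX-length j (c ∷ cs) = s≤s (addToHead-length (timesX (suc j) cs) (timesX-length (suc j) cs))
  where
  addToHead-length : ∀ ds → length ds ≤ suc (length cs) → length (addToHead c ds) ≤ suc (length cs)
  addToHead-length []       _  = s≤s z≤n
  addToHead-length (d ∷ ds) le = le

Poly : ℕ → (ℤ → ℚ) → Set
Poly d φ = Σ (List ℚ) (λ cs → length cs ≤ suc d × (∀ k → φ k ≡ newton 0 cs (fromℤ k)))

-- Polynomials of degree ≤ d have order ≤ d, because x^{(j)} = x^{(j-1)}·(x - (j-1)) does.
order-falling : ∀ j → Order≤ j (λ k → falling j (fromℤ k))
order-falling zero    = order-e 0 z≤n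
order-falling (suc j) = order-cong (λ k → sol (fromℤ k) (falling j (fromℤ k)) (fromℕ j))
  (order-+ (order-weight (order-falling j))
           (order-scale (- fromℕ j) (order-mono (ℕP.n≤1+n j) (order-falling j))))
  where
  sol : ∀ x A s → x * A + (- s) * A ≡ A * (x - s)
  sol = solve-∀ ℚ-ring

order-newton : ∀ j cs d → j ℕ.+ length cs ≤ suc d → Order≤ d (λ k → newton j cs (fromℤ k))
order-newton j []       d le = order-zero
order-newton j (c ∷ cs) d le =
  order-+ (order-scale c (order-mono j≤d (order-falling j))) (order-newton (suc j) cs d le′)
  where
  le′ : suc j ℕ.+ length cs ≤ suc d
  le′ = ℕP.≤-trans (ℕP.≤-reflexive (sym (ℕP.+-suc j (length cs)))) le
  j≤d : j ≤ d
  j≤d = ℕP.≤-pred (ℕP.≤-trans (s≤s (ℕP.m≤m+n j (length cs))) le′)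

poly⇒order : ∀ {d φ} → Poly d φ → Order≤ d φ
poly⇒order {d} (cs , len , eq) = order-cong (λ k → sym (eq k)) (order-newton 0 cs d len)

antidiff-unique : ∀ (g g′ h : ℤ → ℚ) → (∀ k → g (ℤ.suc k) ≡ g k + h k) →
                  (∀ k → g′ (ℤ.suc k) ≡ g′ k + h k) → g (+ 0) ≡ g′ (+ 0) → ∀ k → g k ≡ g′ k
antidiff-unique g g′ h Δg Δg′ g0 (+ zero)     = g0
antidiff-unique g g′ h Δg Δg′ g0 (+ suc n)    =
  trans (Δg (+ n)) (trans (cong (_+ h (+ n)) (antidiff-unique g g′ h Δg Δg′ g0 (+ n))) (sym (Δg′ (+ n))))
antidiff-unique g g′ h Δg Δg′ g0 -[1+ zero ]  =
  +-cancelʳ (h -[1+ 0 ]) _ _ (trans (sym (Δg -[1+ 0 ])) (trans g0 (Δg′ -[1+ 0 ])))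
antidiff-unique g g′ h Δg Δg′ g0 -[1+ suc n ] =
  +-cancelʳ (h -[1+ suc n ]) _ _
    (trans (sym (Δg -[1+ suc n ])) (trans (antidiff-unique g g′ h Δg Δg′ g0 -[1+ n ]) (Δg′ -[1+ suc n ])))

poly-antidiff : ∀ {d} {g h : ℤ → ℚ} → Poly d h → (∀ k → g (ℤ.suc k) ≡ g k + h k) → Poly (suc d) g
poly-antidiff {d} {g} {h} (cs , len , h≡) Δg =
  (g (+ 0) ∷ antidiff 0 cs) , len′ , antidiff-unique g G h Δg ΔG g0≡G0
  where
  len′ : suc (length (antidiff 0 cs)) ≤ suc (suc d)
  len′ = s≤s (ℕP.≤-trans (ℕP.≤-reflexive (antidiff-length 0 cs)) len)
  N : ℚ → ℚ
  N = newton 1 (antidiff 0 cs)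
  G : ℤ → ℚ
  G k = newton 0 (g (+ 0) ∷ antidiff 0 cs) (fromℤ k)
  ΔG : ∀ k → G (ℤ.suc k) ≡ G k + h k
  ΔG k = begin
      g (+ 0) * 1ℚ + N (fromℤ (ℤ.suc k))
    ≡⟨ cong (λ v → g (+ 0) * 1ℚ + N v) (fromℤ-suc k) ⟩
      g (+ 0) * 1ℚ + N (fromℤ k + 1ℚ)
    ≡⟨ cong (λ v → g (+ 0) * 1ℚ + v) (newton-antidiff 0 cs (fromℤ k)) ⟩
      g (+ 0) * 1ℚ + (N (fromℤ k) + newton 0 cs (fromℤ k))
    ≡⟨ sym (ℚP.+-assoc (g (+ 0) * 1ℚ) (N (fromℤ k)) _) ⟩
      G k + newton 0 cs (fromℤ k)
    ≡⟨ cong (λ v → G k + v) (sym (h≡ k)) ⟩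
      G k + h k
    ∎
    where open ≡-Reasoning
  g0≡G0 : g (+ 0) ≡ G (+ 0)
  g0≡G0 = trans (sol (g (+ 0))) (cong (λ v → g (+ 0) * 1ℚ + v) (sym (newton-at-0 0 (antidiff 0 cs))))
    where
    sol : ∀ x → x ≡ x * 1ℚ + 0ℚ
    sol = solve-∀ ℚ-ring

-- e a is a polynomial of degree ≤ a, by e_{a+1}(k) = k·e_a(k)/(a+1).
poly-e : ∀ a → Poly a (e a)
poly-e zero    = (1ℚ ∷ []) , s≤s z≤n , (λ k → refl)
poly-e (suc a) with poly-e a
... | cs , len , e≡ = map (recip a *_) (timesX 0 cs) , len′ , e′≡
  where
  len′ : length (map (recip a *_) (timesX 0 cs)) ≤ suc (suc a)
  len′ = ℕP.≤-trans (ℕP.≤-reflexive (length-map (recip a *_) (timesX 0 cs)))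
           (ℕP.≤-trans (timesX-length 0 cs) (s≤s len))
  e′≡ : ∀ k → e (suc a) k ≡ newton 0 (map (recip a *_) (timesX 0 cs)) (fromℤ k)
  e′≡ k = trans (e-suc k a) (trans (cong (λ v → recip a * (fromℤ k * v)) (e≡ k))
            (sym (trans (newton-scale 0 (recip a) (timesX 0 cs) (fromℤ k))
                        (cong (recip a *_) (newton-timesX 0 cs (fromℤ k))))))

-- μ̂ on monomials as a signed sum

-- signedSum g k = Σ_{0<i≤k} g(i) for k ≥ 0 and -Σ_{k<i≤0} g(i) for k < 0: the
-- antidifference of i ↦ g(i+1) vanishing at 0.
signedSum : (ℤ → ℚ) → ℤ → ℚ
signedSum g (+ zero)     = 0ℚ
signedSum g (+ suc n)    = signedSum g (+ n) + g (+ suc n)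
signedSum g -[1+ zero ]  = - g (+ 0)
signedSum g -[1+ suc n ] = signedSum g -[1+ n ] - g -[1+ n ]

signedSum-step : ∀ g k → signedSum g (ℤ.suc k) ≡ signedSum g k + g (ℤ.suc k)
signedSum-step g (+ n)        = refl
signedSum-step g -[1+ zero ]  = sym (ℚP.+-inverseˡ (g (+ 0)))
signedSum-step g -[1+ suc n ] = sol (signedSum g -[1+ n ]) (g -[1+ n ])
  where
  sol : ∀ s x → s ≡ s - x + x
  sol = solve-∀ ℚ-ring

signedSum-cong : ∀ {g h} → (∀ i → g i ≡ h i) → ∀ k → signedSum g k ≡ signedSum h k
signedSum-cong eq (+ zero)     = refl
signedSum-cong eq (+ suc n)    = cong₂ _+_ (signedSum-cong eq (+ n)) (eq (+ suc n))
signedSum-cong eq -[1+ zero ]  = cong -_ (eq (+ 0))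
signedSum-cong eq -[1+ suc n ] = cong₂ _-_ (signedSum-cong eq -[1+ n ]) (eq -[1+ n ])

signedSum-lin : ∀ α β g h k →
  signedSum (λ i → α * g i + β * h i) k ≡ α * signedSum g k + β * signedSum h k
signedSum-lin α β g h (+ zero)     = sol α β
  where
  sol : ∀ α β → 0ℚ ≡ α * 0ℚ + β * 0ℚ
  sol = solve-∀ ℚ-ring
signedSum-lin α β g h (+ suc n)    =
  trans (cong (_+ (α * g (+ suc n) + β * h (+ suc n))) (signedSum-lin α β g h (+ n)))
        (sol α β (signedSum g (+ n)) (signedSum h (+ n)) (g (+ suc n)) (h (+ suc n)))
  where
  sol : ∀ α β P Q x y → α * P + β * Q + (α * x + β * y) ≡ α * (P + x) + β * (Q + y)
  sol = solve-∀ ℚ-ring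
signedSum-lin α β g h -[1+ zero ]  = sol α β (g (+ 0)) (h (+ 0))
  where
  sol : ∀ α β x y → - (α * x + β * y) ≡ α * (- x) + β * (- y)
  sol = solve-∀ ℚ-ring
signedSum-lin α β g h -[1+ suc n ] =
  trans (cong (_- (α * g -[1+ n ] + β * h -[1+ n ])) (signedSum-lin α β g h -[1+ n ]))
        (sol α β (signedSum g -[1+ n ]) (signedSum h -[1+ n ]) (g -[1+ n ]) (h -[1+ n ]))
  where
  sol : ∀ α β P Q x y → α * P + β * Q - (α * x + β * y) ≡ α * (P - x) + β * (Q - y)
  sol = solve-∀ ℚ-ring

-- The X^a Y^b-coefficient of Σ_{0<i≤k} e^{iX} e^{(k-i)Y}, extended to k ≤ 0 as a signed sum.
conv : ℕ → ℕ → ℤ → ℚ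
conv a b k = signedSum (λ i → e a i * e b (k ℤ.- i)) k

sum1to≡signedSum : ∀ (f : ℕ → PS2) (g : ℤ → ℚ) a b → (∀ i → f i a b ≡ g (+ i)) →
                   ∀ m → sum1to m f a b ≡ signedSum g (+ m)
sum1to≡signedSum f g a b eq zero    = refl
sum1to≡signedSum f g a b eq (suc m) = cong₂ _+_ (sum1to≡signedSum f g a b eq m) (eq (suc m))

sum0to≡signedSum : ∀ (f : ℕ → PS2) (g : ℤ → ℚ) a b → (∀ i → f i a b ≡ g (ℤ.- (+ i))) →
                   ∀ m → sum0to m f a b ≡ - signedSum g -[1+ m ]
sum0to≡signedSum f g a b eq zero    = trans (eq 0) (sym (neg-involutive (g (+ 0))))
sum0to≡signedSum f g a b eq (suc m) =
  trans (cong₂ _+_ (sum0to≡signedSum f g a b eq m) (eq (suc m))) (sol (signedSum g -[1+ m ]) (g -[1+ m ]))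
  where
  sol : ∀ P x → - P + x ≡ - (P - x)
  sol = solve-∀ ℚ-ring

μmono≡-conv : ∀ k a b → μmono k a b ≡ - conv a b k
μmono≡-conv (+ zero)  a b = refl
μmono≡-conv (+ suc n) a b =
  cong -_ (sum1to≡signedSum _ (λ i → e a i * e b (+ suc n ℤ.- i)) a b (λ i → refl) (suc n))
μmono≡-conv -[1+ n ]  a b = sum0to≡signedSum _ (λ i → e a i * e b (-[1+ n ] ℤ.- i)) a b
  (λ i → cong (λ v → expCoef (ℤ.- (+ i)) a * expCoef (-[1+ n ] ℤ.+ v) b) (sym (ℤP.neg-involutive (+ i)))) n

-- Raising b: from e_{b+1}(k-i) = (k-i)·e_b(k-i)/(b+1) and i·e_a(i) = (a+1)·e_{a+1}(i),
--   conv a (b+1) k = (k·conv a b k - (a+1)·conv (a+1) b k)/(b+1).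
conv-step : ∀ a b k → conv a (suc b) k
          ≡ recip b * (fromℤ k * conv a b k) + (- (recip b * fromℕ (suc a))) * conv (suc a) b k
conv-step a b k = trans (signedSum-cong termwise k)
  (trans (signedSum-lin (r * fromℤ k) (- (r * fromℕ (suc a)))
                        (λ i → e a i * e b (k ℤ.- i)) (λ i → e (suc a) i * e b (k ℤ.- i)) k)
         (cong (_+ ((- (r * fromℕ (suc a))) * conv (suc a) b k)) (ℚP.*-assoc r (fromℤ k) (conv a b k))))
  where
  r = recip b
  termwise : ∀ i → e a i * e (suc b) (k ℤ.- i)
           ≡ r * fromℤ k * (e a i * e b (k ℤ.- i)) + (- (r * fromℕ (suc a))) * (e (suc a) i * e b (k ℤ.- i))
  termwise i = begin
      e a i * e (suc b) (k ℤ.- i)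
    ≡⟨ cong (e a i *_) (e-suc (k ℤ.- i) b) ⟩
      e a i * (r * (fromℤ (k ℤ.- i) * e b (k ℤ.- i)))
    ≡⟨ cong (λ v → e a i * (r * (v * e b (k ℤ.- i)))) (fromℤ-- k i) ⟩
      e a i * (r * ((fromℤ k - fromℤ i) * e b (k ℤ.- i)))
    ≡⟨ sol1 (e a i) (e b (k ℤ.- i)) r (fromℤ k) (fromℤ i) ⟩
      r * fromℤ k * (e a i * e b (k ℤ.- i)) - r * (fromℤ i * e a i) * e b (k ℤ.- i)
    ≡⟨ cong (λ v → r * fromℤ k * (e a i * e b (k ℤ.- i)) - r * v * e b (k ℤ.- i)) (e-step i a) ⟩
      r * fromℤ k * (e a i * e b (k ℤ.- i)) - r * (fromℕ (suc a) * e (suc a) i) * e b (k ℤ.- i)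
    ≡⟨ sol2 (e a i) (e b (k ℤ.- i)) r (fromℤ k) (fromℕ (suc a)) (e (suc a) i) ⟩
      r * fromℤ k * (e a i * e b (k ℤ.- i)) + (- (r * fromℕ (suc a))) * (e (suc a) i * e b (k ℤ.- i))
    ∎
    where
    open ≡-Reasoning
    sol1 : ∀ ea eb q xk xi → ea * (q * ((xk - xi) * eb)) ≡ q * xk * (ea * eb) - q * (xi * ea) * eb
    sol1 = solve-∀ ℚ-ring
    sol2 : ∀ ea eb q xk s E → q * xk * (ea * eb) - q * (s * E) * eb
                            ≡ q * xk * (ea * eb) + (- (q * s)) * (E * eb)
    sol2 = solve-∀ ℚ-ring

-- conv a 0 is the summatory function of e a, a polynomial of degree ≤ a+1.
order-conv-0 : ∀ a → Order≤ (suc a) (conv a 0)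
order-conv-0 a = order-cong conv≡
  (order-+ (poly⇒order (poly-antidiff {g = g} (poly-e a) Δg))
           (order-mono (ℕP.n≤1+n a) (poly⇒order (poly-e a))))
  where
  g : ℤ → ℚ
  g k = signedSum (e a) k - e a k
  Δg : ∀ k → g (ℤ.suc k) ≡ g k + e a k
  Δg k = trans (cong (_- e a (ℤ.suc k)) (signedSum-step (e a) k))
               (sol (signedSum (e a) k) (e a (ℤ.suc k)) (e a k))
    where
    sol : ∀ F x y → F + x - x ≡ F - y + y
    sol = solve-∀ ℚ-ring
  sol : ∀ F y → F - y + y ≡ F
  sol = solve-∀ ℚ-ring
  conv≡ : ∀ k → g k + e a k ≡ conv a 0 k
  conv≡ k = trans (sol (signedSum (e a) k) (e a k)) (signedSum-cong (λ i → sym (ℚP.*-identityʳ (e a i))) k)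

order-conv : ∀ b a → Order≤ (suc (a ℕ.+ b)) (conv a b)
order-conv zero    a = order-mono (ℕP.≤-reflexive (cong suc (sym (ℕP.+-identityʳ a)))) (order-conv-0 a)
order-conv (suc b) a = order-mono (ℕP.≤-reflexive (cong suc (sym (ℕP.+-suc a b))))
  (order-cong (λ k → sym (conv-step a b k))
    (order-+ (order-scale (recip b) (order-weight (order-conv b a)))
             (order-scale (- (recip b * fromℕ (suc a))) (order-conv b (suc a)))))

μ̂-local : ∀ a b L M → (∀ n → n ≤ suc (a ℕ.+ b) → embed L n ≡ embed M n) → μ̂ L a b ≡ μ̂ M a b
μ̂-local a b L M agree = begin
    μ̂ L a b
  ≡⟨ μ̂≡pair L a b ⟩
    pair L (λ k → μmono k a b)
  ≡⟨ order-agree order-μmono L M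
      (λ n n≤ → trans (sym (embed≡pair L n)) (trans (agree n n≤) (embed≡pair M n))) ⟩
    pair M (λ k → μmono k a b)
  ≡⟨ sym (μ̂≡pair M a b) ⟩
    μ̂ M a b
  ∎
  where
  open ≡-Reasoning
  sol : ∀ x → (- 1ℚ) * x ≡ - x
  sol = solve-∀ ℚ-ring
  order-μmono : Order≤ (suc (a ℕ.+ b)) (λ k → μmono k a b)
  order-μmono = order-cong (λ k → trans (sol (conv a b k)) (sym (μmono≡-conv k a b)))
                           (order-scale (- 1ℚ) (order-conv b a))

-- Density of ℚ[z,z⁻¹] in ℚ[[Z]]

z-1^ : ℕ → Laurent
z-1^ zero    = (+ 0 , 1ℚ) ∷ []
z-1^ (suc N) = shiftL (z-1^ N) ++ scaleL (- 1ℚ) (z-1^ N)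

-- Pairing with (z-1)^N is the N-th forward difference at 0.
pair-z-1^-suc : ∀ N φ →
  pair (z-1^ (suc N)) φ ≡ pair (z-1^ N) (λ k → φ (ℤ.suc k)) + (- 1ℚ) * pair (z-1^ N) φ
pair-z-1^-suc N φ =
  trans (pair-++ (shiftL (z-1^ N)) _ φ) (cong₂ _+_ (pair-shiftL (z-1^ N) φ) (pair-scaleL (- 1ℚ) (z-1^ N) φ))

pair-z-1^-weight : ∀ N φ → pair (z-1^ (suc N)) (λ k → fromℤ k * φ k)
                         ≡ fromℕ (suc N) * pair (z-1^ N) (λ k → φ (ℤ.suc k))
pair-z-1^-weight zero    φ = trans (pair-z-1^-suc 0 (λ k → fromℤ k * φ k)) (sol (φ (+ 1)) (φ (+ 0)))
  where
  sol : ∀ a b → 1ℚ * (1ℚ * a) + 0ℚ + (- 1ℚ) * (1ℚ * (0ℚ * b) + 0ℚ) ≡ (0ℚ + 1ℚ) * (1ℚ * a + 0ℚ)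
  sol = solve-∀ ℚ-ring
pair-z-1^-weight (suc N) φ = begin
    pair (z-1^ (suc (suc N))) (λ k → fromℤ k * φ k)
  ≡⟨ pair-z-1^-suc (suc N) _ ⟩
    pair P (λ k → fromℤ (ℤ.suc k) * φ (ℤ.suc k)) + (- 1ℚ) * pair P (λ k → fromℤ k * φ k)
  ≡⟨ cong (_+ ((- 1ℚ) * pair P (λ k → fromℤ k * φ k))) (pair-cong P shifted-weight) ⟩
    pair P (λ k → fromℤ k * φ (ℤ.suc k) + φ (ℤ.suc k)) + (- 1ℚ) * pair P (λ k → fromℤ k * φ k)
  ≡⟨ cong (_+ ((- 1ℚ) * pair P (λ k → fromℤ k * φ k))) (pair-+ P _ _) ⟩
    pair P (λ k → fromℤ k * φ (ℤ.suc k)) + Δφ + (- 1ℚ) * pair P (λ k → fromℤ k * φ k)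
  ≡⟨ cong₂ (λ u v → u + Δφ + (- 1ℚ) * v) (pair-z-1^-weight N (λ k → φ (ℤ.suc k))) (pair-z-1^-weight N φ) ⟩
    s * pair (z-1^ N) (λ k → φ (ℤ.suc (ℤ.suc k))) + Δφ + (- 1ℚ) * (s * pair (z-1^ N) (λ k → φ (ℤ.suc k)))
  ≡⟨ sol s (pair (z-1^ N) (λ k → φ (ℤ.suc (ℤ.suc k)))) (pair (z-1^ N) (λ k → φ (ℤ.suc k))) Δφ ⟩
    s * (pair (z-1^ N) (λ k → φ (ℤ.suc (ℤ.suc k))) + (- 1ℚ) * pair (z-1^ N) (λ k → φ (ℤ.suc k))) + Δφ
  ≡⟨ cong (λ v → s * v + Δφ) (sym (pair-z-1^-suc N (λ k → φ (ℤ.suc k)))) ⟩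
    s * Δφ + Δφ
  ≡⟨ sol2 s Δφ ⟩
    (s + 1ℚ) * Δφ
  ∎
  where
  open ≡-Reasoning
  P = z-1^ (suc N)
  s = fromℕ (suc N)
  Δφ = pair P (λ k → φ (ℤ.suc k))
  shifted-weight : ∀ k → fromℤ (ℤ.suc k) * φ (ℤ.suc k) ≡ fromℤ k * φ (ℤ.suc k) + φ (ℤ.suc k)
  shifted-weight k = trans (cong (_* φ (ℤ.suc k)) (fromℤ-suc k)) (sol0 (fromℤ k) (φ (ℤ.suc k)))
    where
    sol0 : ∀ x y → (x + 1ℚ) * y ≡ x * y + y
    sol0 = solve-∀ ℚ-ring
  sol : ∀ s A B P → s * A + P + (- 1ℚ) * (s * B) ≡ s * (A + (- 1ℚ) * B) + P
  sol = solve-∀ ℚ-ring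
  sol2 : ∀ s P → s * P + P ≡ (s + 1ℚ) * P
  sol2 = solve-∀ ℚ-ring

-- Combining with e_{m+1}(k) = k·e_m(k)/(m+1) gives a recursion in m and N.
pair-z-1^-e : ∀ m N → pair (z-1^ (suc N)) (e (suc m))
                    ≡ recip m * (fromℕ (suc N) * (pair (z-1^ N) (e m) + pair (z-1^ (suc N)) (e m)))
pair-z-1^-e m N = begin
    pair (z-1^ (suc N)) (e (suc m))
  ≡⟨ pair-cong (z-1^ (suc N)) (λ k → e-suc k m) ⟩
    pair (z-1^ (suc N)) (λ k → recip m * (fromℤ k * e m k))
  ≡⟨ pair-scale (z-1^ (suc N)) (recip m) _ ⟩
    recip m * pair (z-1^ (suc N)) (λ k → fromℤ k * e m k)
  ≡⟨ cong (recip m *_) (pair-z-1^-weight N (e m)) ⟩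
    recip m * (fromℕ (suc N) * pair (z-1^ N) (λ k → e m (ℤ.suc k)))
  ≡⟨ cong (λ v → recip m * (fromℕ (suc N) * v)) shift ⟩
    recip m * (fromℕ (suc N) * (pair (z-1^ N) (e m) + pair (z-1^ (suc N)) (e m)))
  ∎
  where
  open ≡-Reasoning
  sol : ∀ P1 P0 → P1 ≡ P0 + (P1 + (- 1ℚ) * P0)
  sol = solve-∀ ℚ-ring
  shift : pair (z-1^ N) (λ k → e m (ℤ.suc k)) ≡ pair (z-1^ N) (e m) + pair (z-1^ (suc N)) (e m)
  shift = trans (sol _ (pair (z-1^ N) (e m)))
                (cong (λ v → pair (z-1^ N) (e m) + v) (sym (pair-z-1^-suc N (e m))))

z-1^-low : ∀ n N → n < N → pair (z-1^ N) (e n) ≡ 0ℚ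
z-1^-low zero    (suc N) _ = trans (pair-z-1^-suc N (e 0)) (sol (pair (z-1^ N) (e 0)))
  where
  sol : ∀ P → P + (- 1ℚ) * P ≡ 0ℚ
  sol = solve-∀ ℚ-ring
z-1^-low (suc m) (suc N) (s≤s m<N) = trans (pair-z-1^-e m N)
  (trans (cong₂ (λ u v → recip m * (fromℕ (suc N) * (u + v)))
                (z-1^-low m N m<N) (z-1^-low m (suc N) (ℕP.m≤n⇒m≤1+n m<N)))
         (sol (recip m) (fromℕ (suc N))))
  where
  sol : ∀ a b → a * (b * (0ℚ + 0ℚ)) ≡ 0ℚ
  sol = solve-∀ ℚ-ring

z-1^-lead : ∀ N → pair (z-1^ N) (e N) ≡ 1ℚ
z-1^-lead zero    = refl
z-1^-lead (suc M) = trans (pair-z-1^-e M M)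
  (trans (cong₂ (λ u v → recip M * (fromℕ (suc M) * (u + v))) (z-1^-lead M) (z-1^-low M (suc M) (ℕP.n<1+n M)))
         (trans (sol (recip M) (fromℕ (suc M))) (fromℕ-recip M)))
  where
  sol : ∀ a b → a * (b * (1ℚ + 0ℚ)) ≡ b * a
  sol = solve-∀ ℚ-ring

-- A Laurent polynomial agreeing with f below Z^N, built by correcting the Z^N-coefficient
-- of the previous approximation with a multiple of (z-1)^N.
approx : PS1 → ℕ → Laurent
approx f zero    = []
approx f (suc N) = approx f N ++ scaleL (f N - embed (approx f N) N) (z-1^ N)

embed-approx-suc : ∀ f N n → embed (approx f (suc N)) n
                 ≡ embed (approx f N) n + (f N - embed (approx f N) N) * pair (z-1^ N) (e n)
embed-approx-suc f N n = trans (embed≡pair (approx f (suc N)) n)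
  (trans (pair-++ (approx f N) (scaleL c (z-1^ N)) (e n))
         (cong₂ _+_ (sym (embed≡pair (approx f N) n)) (pair-scaleL c (z-1^ N) (e n))))
  where c = f N - embed (approx f N) N

approx-correct : ∀ f N n → n < N → embed (approx f N) n ≡ f n
approx-correct f (suc N) n n<N+1 with ℕP.m<1+n⇒m<n∨m≡n n<N+1
... | inj₁ n<N  = trans (embed-approx-suc f N n)
  (trans (cong₂ (λ u v → u + (f N - embed (approx f N) N) * v) (approx-correct f N n n<N) (z-1^-low n N n<N))
         (sol (f n) (f N - embed (approx f N) N)))
  where
  sol : ∀ x c → x + c * 0ℚ ≡ x
  sol = solve-∀ ℚ-ring
... | inj₂ refl = trans (embed-approx-suc f N N)
  (trans (cong (λ v → embed (approx f N) N + (f N - embed (approx f N) N) * v) (z-1^-lead N))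
         (sol (embed (approx f N) N) (f N)))
  where
  sol : ∀ x y → x + (y - x) * 1ℚ ≡ y
  sol = solve-∀ ℚ-ring

-- The continuous extension

extension : PS1 → PS2
extension f a b = μ̂ (approx f (suc (suc (a ℕ.+ b)))) a b

-- By locality, every such A computes this coefficient.
extension-local : ∀ f a b L → (∀ n → n ≤ suc (a ℕ.+ b) → embed L n ≡ f n) → μ̂ L a b ≡ extension f a b
extension-local f a b L agree =
  μ̂-local a b L (approx f N) (λ n n≤ → trans (agree n n≤) (sym (approx-correct f N n (s≤s n≤))))
  where N = suc (suc (a ℕ.+ b))

extension-continuous : Continuous extension
extension-continuous f p = suc p , λ g f≡g a b a+b<p →
  extension-local g a b (approx f (suc (suc (a ℕ.+ b))))
    (λ n n≤ → trans (approx-correct f (suc (suc (a ℕ.+ b))) n (s≤s n≤)) (f≡g n (s≤s (ℕP.≤-trans n≤ a+b<p))))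

extension-extends : Extends extension
extension-extends L a b = sym (extension-local (embed L) a b L (λ _ _ → refl))

-- A continuous extension Ψ is determined on f by its values on a Laurent polynomial A
-- agreeing with f far enough for both continuity of Ψ and locality of μ̂.
extension-unique : ∀ (Ψ : PS1 → PS2) → Continuous Ψ → Extends Ψ → ∀ f → Ψ f ≈₂ extension f
extension-unique Ψ Ψ-cont Ψ-ext f a b with Ψ-cont f (suc (a ℕ.+ b))
... | q , Ψ-local = begin
    Ψ f a b
  ≡⟨ Ψ-local (embed A) (λ n n<q → sym (approx-correct f N n (ℕP.<-≤-trans n<q (ℕP.m≤m+n q _))))
              a b (ℕP.n<1+n _) ⟩
    Ψ (embed A) a b
  ≡⟨ Ψ-ext A a b ⟩
    μ̂ A a b
  ≡⟨ extension-local f a b A (λ n n≤ → approx-correct f N n (ℕP.<-≤-trans (s≤s n≤) (ℕP.m≤n+m _ q))) ⟩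
    extension f a b
  ∎
  where
  open ≡-Reasoning
  N = q ℕ.+ suc (suc (a ℕ.+ b))
  A = approx f N

lemma3p1 : Σ (PS1 → PS2) (λ Φ → Continuous Φ × Extends Φ ×
    (∀ (Ψ : PS1 → PS2) → Continuous Ψ → Extends Ψ → ∀ (f : PS1) → Ψ f ≈₂ Φ f))
lemma3p1 = extension , extension-continuous , extension-extends , extension-unique
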